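{- Let $I=\langle\mathcal{A}^+\cdot\mathcal{A}^+\rangle$ be the tridendriform ideal of $\mathcal{A}^+$ generated by $\{x\cdot y:x,y\in\mathcal{A}^+\}$. Then $I$ is a $(3,2)$-dendriform biideal of $(\mathcal{A},\prec,\cdot,\succ,\Delta_\leftarrow,\Delta_\rightarrow)$: it is a tridendriform ideal, $\varepsilon(I)=0$, and $\Delta_\leftarrow(I)\subseteq I\otimes\mathcal{A}+\mathcal{A}\otimes I$ and $\Delta_\rightarrow(I)\subseteq I\otimes\mathcal{A}+\mathcal{A}\otimes I$.
   Context: A reduced tree is a planar rooted tree (root edge below the root, leaves as top edges) whose internal vertices have at least two children; $|$ is the one-leaf tree; $T_n$ = reduced trees with $n+1$ leaves; $\mathcal{A}=\bigoplus_{n\ge0}\mathbb{K}T_n$, $\mathcal{A}^+=\bigoplus_{n\ge1}\mathbb{K}T_n$. With $x^{(0)}\vee\cdots\vee x^{(k)}$ the grafting of trees left to right on a new root, recursively $x\prec y=x^{(0)}\vee\cdots\vee x^{(k-1)}\vee(x^{(k)}*y)$, $x\cdot y=x^{(0)}\vee\cdots\vee x^{(k-1)}\vee(x^{(k)}*y^{(0)})\vee y^{(1)}\vee\cdots\vee y^{(l)}$, $x\succ y=(x*y^{(0)})\vee y^{(1)}\vee\cdots\vee y^{(l)}$, $*=\prec+\cdot+\succ$, $|$ the unit; for $a\in\mathcal{A}^+$: $|\prec a=0$, $a\prec|=a$, $|\succ a=a$, $a\succ|=0$, $|\cdot a=a\cdot|=0$. A tridendriform ideal is a subspace $I$ such that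 $x\ltimes y\in I$ for $\ltimes\in\{\prec,\cdot,\succ\}$ whenever $x\in I$ or $y\in I$. $\varepsilon(|)=1$, $\varepsilon(\mathcal{A}^+)=0$. Admissible cuts: an internal edge joins two internal vertices; an admissible cut is a nonempty set $c$ of internal edges with at most one on each root-to-leaf path, or the empty cut, or the total cut; removing the edges of a nonempty non-total $c$ gives subtrees $G^c_1(t),\dots,G^c_m(t)$ (left to right; cut edges become root edges) and the root component $P^c(t)$ (cut edges become leaves), $G^c(t)=G^c_1(t)*\cdots*G^c_m(t)$; empty cut: $P^c=t,G^c=|$; total cut: $P^c=|,G^c=t$. For trees $t\ne|$: $\Delta_\leftarrow(t)=\sum G^c(t)\otimes P^c(t)$ over admissible cuts with the right-most leaf of $t$ in some $G^c_i(t)$ (incl. total cut), and $\Delta_\rightarrow(t)=\sum G^c(t)\otimes P^c(t)$ over admissible cuts with the right-most leaf in $P^c(t)$ (incl. empty cut); extended linearly. -}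

module Defs where

open import Level using (Level; _⊔_; suc)
open import Algebra.Bundles using (CommutativeRing)
open import Data.List using (List; []; _∷_; _++_; map; concatMap; foldr)
open import Data.List.Relation.Unary.All using (All)
open import Data.Product using (_×_; _,_; proj₁; proj₂; Σ; ∃)
open import Data.Bool using (Bool; true; false; if_then_else_)
open import Relation.Nullary using (¬_; Dec; yes; no)
open import Relation.Binary.PropositionalEquality using (_≡_; refl; cong; cong₂)

record Field (c ℓ : Level) : Set (Level.suc (c ⊔ ℓ)) where
  field
    commutativeRing : CommutativeRing c ℓ
  open CommutativeRing commutativeRing public
  field
    0≉1     : ¬ (0# ≈ 1#)
    inverse : ∀ x → ¬ (x ≈ 0#) → Σ Carrier (λ y → x * y ≈ 1#)

-- Planar reduced rooted trees.
-- leaf = the one-leaf tree |.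
-- node a ms z = a ∨ m₁ ∨ ... ∨ mⱼ ∨ z : an internal root vertex with
-- first child a, middle children ms (possibly none) and last child z;
-- hence every internal vertex has at least two children.

data Tree : Set where
  leaf : Tree
  node : Tree → List Tree → Tree → Tree

mutual
  _≟T_ : (s t : Tree) → Dec (s ≡ t)
  leaf ≟T leaf = yes refl
  leaf ≟T node _ _ _ = no (λ ())
  node _ _ _ ≟T leaf = no (λ ())
  node a ms z ≟T node b ns w with a ≟T b | ms ≟L ns | z ≟T w
  ... | yes refl | yes refl | yes refl = yes refl
  ... | no p | _ | _ = no (λ { refl → p refl })
  ... | yes _ | no p | _ = no (λ { refl → p refl })
  ... | yes _ | yes _ | no p = no (λ { refl → p refl })

  _≟L_ : (ss ts : List Tree) → Dec (ss ≡ ts)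
  [] ≟L [] = yes refl
  [] ≟L (_ ∷ _) = no (λ ())
  (_ ∷ _) ≟L [] = no (λ ())
  (s ∷ ss) ≟L (t ∷ ts) with s ≟T t | ss ≟L ts
  ... | yes refl | yes refl = yes refl
  ... | no p | _ = no (λ { refl → p refl })
  ... | yes _ | no p = no (λ { refl → p refl })

_≟T2_ : (s t : Tree × Tree) → Dec (s ≡ t)
(s₁ , s₂) ≟T2 (t₁ , t₂) with s₁ ≟T t₁ | s₂ ≟T t₂
... | yes refl | yes refl = yes refl
... | no p | _ = no (λ { refl → p refl })
... | yes _ | no p = no (λ { refl → p refl })

-- Admissible cuts of a tree (other than the total cut).
-- A cut is recorded as (G , P , r): G = the list G₁,…,Gₘ of cut-off
-- subtrees (left to right; G = [] is the empty cut), P = the root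
-- component, r = true iff the right-most leaf lies in some Gᵢ.
-- At each child edge of an internal vertex one either cuts the edge
-- (only allowed when the child is internal, i.e. the edge is an internal
-- edge), or does not cut it and chooses a cut inside the child.  This
-- enumerates exactly the sets of internal edges with at most one edge on
-- each root-to-leaf path (the empty set included), each once.

Cut : Set
Cut = List Tree × Tree × Bool

mutual
  cuts : Tree → List Cut
  cuts leaf = ([] , leaf , false) ∷ []
  cuts (node a ms z) =
    concatMap (λ ca →
      concatMap (λ cms →
        map (λ cz → combine ca cms cz) (childCuts z))
        (childCutsL ms))
      (childCuts a)
    where
    combine : Cut → (List Tree × List Tree) → Cut → Cut
    combine (ga , pa , _) (gm , pm) (gz , pz , rz) =
      (ga ++ gm ++ gz , node pa pm pz , rz)

  childCuts : Tree → List Cut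
  childCuts leaf = ([] , leaf , false) ∷ []
  childCuts (node a ms z) =
    (node a ms z ∷ [] , leaf , true) ∷ cuts (node a ms z)

  childCutsL : List Tree → List (List Tree × List Tree)
  childCutsL [] = ([] , []) ∷ []
  childCutsL (t ∷ ts) =
    concatMap (λ c →
      map (λ r → (proj₁ c ++ proj₁ r , proj₁ (proj₂ c) ∷ proj₂ r))
        (childCutsL ts))
      (childCuts t)

-- The algebra 𝒜 over a field K: formal finite linear combinations of
-- trees, compared coefficient-wise.

module Tri {c ℓ : Level} (K : Field c ℓ) where
  open Field K

  FS : Set c
  FS = List (Carrier × Tree)

  FS2 : Set c
  FS2 = List (Carrier × (Tree × Tree))

  coeff : Tree → FS → Carrier
  coeff t [] = 0#
  coeff t ((a , s) ∷ u) with s ≟T t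
  ... | yes _ = a + coeff t u
  ... | no _ = coeff t u

  coeff2 : Tree × Tree → FS2 → Carrier
  coeff2 t [] = 0#
  coeff2 t ((a , s) ∷ u) with s ≟T2 t
  ... | yes _ = a + coeff2 t u
  ... | no _ = coeff2 t u

  _≋_ : FS → FS → Set ℓ
  u ≋ v = ∀ t → coeff t u ≈ coeff t v

  _≋2_ : FS2 → FS2 → Set ℓ
  u ≋2 v = ∀ t → coeff2 t u ≈ coeff2 t v

  ⟦_⟧ : Tree → FS
  ⟦ t ⟧ = (1# , t) ∷ []

  zeroV : FS
  zeroV = []

  _⊕_ : FS → FS → FS
  u ⊕ v = u ++ v

  _·ₛ_ : Carrier → FS → FS
  a ·ₛ u = map (λ p → (a * proj₁ p , proj₂ p)) u

  bilin : (Tree → Tree → FS) → FS → FS → FS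
  bilin op u v =
    concatMap (λ p → concatMap (λ q → (proj₁ p * proj₁ q) ·ₛ op (proj₂ p) (proj₂ q)) v) u

  lin2 : (Tree → FS2) → FS → FS2
  lin2 f u = concatMap (λ p → map (λ q → (proj₁ p * proj₁ q , proj₂ q)) (f (proj₂ p))) u

  _⊗_ : FS → FS → FS2
  u ⊗ v = concatMap (λ p → map (λ q → (proj₁ p * proj₁ q , (proj₂ p , proj₂ q))) v) u

  ε : FS → Carrier
  ε u = coeff leaf u

  InA⁺ : FS → Set ℓ
  InA⁺ u = coeff leaf u ≈ 0#

  graftLast : Tree → List Tree → FS → FS
  graftLast a ms u = map (λ p → (proj₁ p , node a ms (proj₂ p))) u

  graftFirst : FS → List Tree → Tree → FS
  graftFirst u ns w = map (λ p → (proj₁ p , node (proj₂ p) ns w)) u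

  graftMid : Tree → List Tree → FS → List Tree → Tree → FS
  graftMid a ms u ns w = map (λ p → (proj₁ p , node a (ms ++ proj₂ p ∷ ns) w)) u

  -- the tridendriform operations on trees
  -- (| ≺ |, | · |, | ≻ | are not defined in the paper; they are set to 0
  -- here; since | * | = |, these values never matter)
  mutual
    precT : Tree → Tree → FS
    precT leaf _ = zeroV
    precT (node a ms z) leaf = ⟦ node a ms z ⟧
    precT (node a ms z) (node b ns w) = graftLast a ms (starT z (node b ns w))

    dotT : Tree → Tree → FS
    dotT leaf _ = zeroV
    dotT (node a ms z) leaf = zeroV
    dotT (node a ms z) (node b ns w) = graftMid a ms (starT z b) ns w

    succT : Tree → Tree → FS
    succT _ leaf = zeroV
    succT leaf (node b ns w) = ⟦ node b ns w ⟧
    succT (node a ms z) (node b ns w) = graftFirst (starT (node a ms z) b) ns w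

    starT : Tree → Tree → FS
    starT leaf leaf = ⟦ leaf ⟧
    starT leaf (node b ns w) = succT leaf (node b ns w)
    starT (node a ms z) y = precT (node a ms z) y ⊕ (dotT (node a ms z) y ⊕ succT (node a ms z) y)

  _≺_ _·_ _≻_ _✶_ : FS → FS → FS
  _≺_ = bilin precT
  _·_ = bilin dotT
  _≻_ = bilin succT
  _✶_ = bilin starT

  starList : List Tree → FS
  starList [] = ⟦ leaf ⟧
  starList (g ∷ []) = ⟦ g ⟧
  starList (g ∷ gs@(_ ∷ _)) = ⟦ g ⟧ ✶ starList gs

  cutTerm : Cut → FS2
  cutTerm (gs , p , _) = starList gs ⊗ ⟦ p ⟧

  selectR : Bool → List Cut → List Cut
  selectR b [] = []
  selectR b ((gs , p , r) ∷ cs) =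
    if r Data.Bool.∧ b Data.Bool.∨ (Data.Bool.not r Data.Bool.∧ Data.Bool.not b)
    then (gs , p , r) ∷ selectR b cs else selectR b cs

  -- Δ← and Δ→ on trees (Δ(|) is not defined in the paper; set to 0)
  Δ←T : Tree → FS2
  Δ←T leaf = []
  Δ←T t = (⟦ t ⟧ ⊗ ⟦ leaf ⟧) ++ concatMap cutTerm (selectR true (cuts t))

  Δ→T : Tree → FS2
  Δ→T leaf = []
  Δ→T t = concatMap cutTerm (selectR false (cuts t))

  Δ← Δ→ : FS → FS2
  Δ← = lin2 Δ←T
  Δ→ = lin2 Δ→T

  data InI : FS → Set (c ⊔ ℓ) where
    gen    : ∀ {x y} → InA⁺ x → InA⁺ y → InI (x · y)
    zeroI  : InI zeroV
    addI   : ∀ {u v} → InI u → InI v → InI (u ⊕ v)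
    scaleI : ∀ a {u} → InI u → InI (a ·ₛ u)
    respI  : ∀ {u v} → u ≋ v → InI u → InI v
    ≺ˡ     : ∀ {x y} → InI x → InA⁺ y → InI (x ≺ y)
    ≺ʳ     : ∀ {x y} → InA⁺ x → InI y → InI (x ≺ y)
    ·ˡ     : ∀ {x y} → InI x → InA⁺ y → InI (x · y)
    ·ʳ     : ∀ {x y} → InA⁺ x → InI y → InI (x · y)
    ≻ˡ     : ∀ {x y} → InI x → InA⁺ y → InI (x ≻ y)
    ≻ʳ     : ∀ {x y} → InA⁺ x → InI y → InI (x ≻ y)

  InI⊗A+A⊗I : FS2 → Set (c ⊔ ℓ)
  InI⊗A+A⊗I w =
    Σ (List (FS × FS)) λ L₁ → Σ (List (FS × FS)) λ L₂ →
      All (λ p → InI (proj₁ p)) L₁ × All (λ p → InI (proj₂ p)) L₂ ×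
      (w ≋2 (concatMap (λ p → proj₁ p ⊗ proj₂ p) L₁ ++ concatMap (λ p → proj₁ p ⊗ proj₂ p) L₂))

  IsTriIdeal : (FS → Set (c ⊔ ℓ)) → Set (c ⊔ ℓ)
  IsTriIdeal J =
    (∀ {x} y → J x → J (x ≺ y) × J (x · y) × J (x ≻ y)) ×
    (∀ x {y} → J y → J (x ≺ y) × J (x · y) × J (x ≻ y))

  IsBiidealI : Set (c ⊔ ℓ)
  IsBiidealI =
    IsTriIdeal InI ×
    (∀ {x} → InI x → ε x ≈ 0#) ×
    (∀ {x} → InI x → InI⊗A+A⊗I (Δ← x)) ×
    (∀ {x} → InI x → InI⊗A+A⊗I (Δ→ x))

-- I is the span of the non-binary trees, those having a vertex with at least
-- three children.  Each of them lies in I: a wide root splits it as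
-- (a ∨ |) · (m ∨ ⋯ ∨ z), otherwise it is a ≻ (| ∨ z) or (a ∨ |) ≺ z with a
-- smaller non-binary a or z.  Conversely · only produces non-binary trees, and
-- so do ≺, ≻ and * as soon as one argument is non-binary; hence the span is a
-- tridendriform ideal, and ε vanishes on it because | is binary.  An admissible
-- cut of a non-binary tree leaves a wide vertex in the root component P or in
-- some cut-off subtree Gᵢ, and then G₁ * ⋯ * Gₘ is non-binary; so every term
-- G ⊗ P of Δ← and Δ→ lies in I ⊗ 𝒜 or in 𝒜 ⊗ I.
module Submission where

open import Defs
open import Level using (Level; _⊔_)
open import Function using (_∘_)
open import Data.Empty using (⊥)
open import Data.Unit using (⊤; tt)
open import Data.Sum as Sum using (_⊎_; inj₁; inj₂)
open import Data.Product using (Σ; _×_; _,_; proj₁; proj₂; map₁)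
open import Data.Bool using (true; false)
open import Data.Nat using (suc; _≤_; s≤s)
open import Data.Nat.Properties using (≤-refl; ≤-trans; m≤n⇒m≤1+n)
open import Data.List using (List; []; _∷_; _++_; map; concat; concatMap; length)
open import Data.List.Properties using (concatMap-++; ++-identityʳ)
open import Data.List.Relation.Unary.All as All using (All; []; _∷_)
open import Data.List.Relation.Unary.All.Properties using (++⁺; concat⁺; map⁺)
open import Data.List.Relation.Unary.Any using (Any; here; there)
open import Data.List.Relation.Unary.Any.Properties using (++⁺ˡ; ++⁺ʳ)
open import Relation.Nullary using (¬_; yes; no; contradiction)
open import Relation.Binary.PropositionalEquality as ≡ using (_≡_)

NonBinary : Tree → Set
NonBinary leaf = ⊥
NonBinary (node a [] z) = NonBinary a ⊎ NonBinary z
NonBinary (node a (_ ∷ _) z) = ⊤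

nonBinary-nodeˡ : ∀ {a} ms z → NonBinary a → NonBinary (node a ms z)
nonBinary-nodeˡ [] z h = inj₁ h
nonBinary-nodeˡ (_ ∷ _) z h = tt

nonBinary-nodeʳ : ∀ a ms {z} → NonBinary z → NonBinary (node a ms z)
nonBinary-nodeʳ a [] h = inj₂ h
nonBinary-nodeʳ a (_ ∷ _) h = tt

nonBinary-node-wide : ∀ a ms x ns w → NonBinary (node a (ms ++ x ∷ ns) w)
nonBinary-node-wide a [] x ns w = tt
nonBinary-node-wide a (_ ∷ _) x ns w = tt

nonBinary-node-first : ∀ a ms z → NonBinary (node a ms z) →
                       NonBinary a ⊎ (∀ a′ → NonBinary (node a′ ms z))
nonBinary-node-first a [] z (inj₁ ha) = inj₁ ha
nonBinary-node-first a [] z (inj₂ hz) = inj₂ (λ _ → inj₂ hz)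
nonBinary-node-first a (_ ∷ _) z _ = inj₂ (λ _ → tt)

nonBinary-node-last : ∀ a ms z → NonBinary (node a ms z) →
                      NonBinary z ⊎ (∀ z′ → NonBinary (node a ms z′))
nonBinary-node-last a [] z (inj₁ ha) = inj₂ (λ _ → inj₁ ha)
nonBinary-node-last a [] z (inj₂ hz) = inj₁ hz
nonBinary-node-last a (_ ∷ _) z _ = inj₂ (λ _ → tt)

KeepsNonBinary : Tree → Cut → Set
KeepsNonBinary t (gs , p , _) = NonBinary t → NonBinary p ⊎ Any NonBinary gs

childCutsL-length : ∀ ms → All (λ c → length (proj₂ c) ≡ length ms) (childCutsL ms)
childCutsL-length [] = ≡.refl ∷ []
childCutsL-length (t ∷ ts) =
  concat⁺ (map⁺ (All.universal
    (λ _ → map⁺ (All.map (≡.cong suc) (childCutsL-length ts))) (childCuts t)))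

combine-keepsNonBinary :
  ∀ {a ms z} (ca : Cut) (cms : List Tree × List Tree) (cz : Cut) →
  KeepsNonBinary a ca → length (proj₂ cms) ≡ length ms → KeepsNonBinary z cz →
  KeepsNonBinary (node a ms z)
    ( proj₁ ca ++ proj₁ cms ++ proj₁ cz
    , node (proj₁ (proj₂ ca)) (proj₂ cms) (proj₁ (proj₂ cz))
    , proj₂ (proj₂ cz))
combine-keepsNonBinary {ms = _ ∷ _} _ (_ , _ ∷ _) _ _ _ _ _ = inj₁ tt
combine-keepsNonBinary {ms = []} _ (_ , []) _ ka _ kz (inj₁ ha) =
  Sum.map inj₁ ++⁺ˡ (ka ha)
combine-keepsNonBinary {ms = []} (ga , _) (gm , []) _ ka _ kz (inj₂ hz) =
  Sum.map inj₂ (++⁺ʳ ga ∘ ++⁺ʳ gm) (kz hz)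

mutual
  cuts-keepNonBinary : ∀ t → All (KeepsNonBinary t) (cuts t)
  cuts-keepNonBinary leaf = (λ ()) ∷ []
  cuts-keepNonBinary (node a ms z) =
    concat⁺ (map⁺ (All.map (λ {ca} ka →
      concat⁺ (map⁺ (All.map (λ {cms} lm →
        map⁺ (All.map (λ {cz} kz → combine-keepsNonBinary ca cms cz ka lm kz)
          (childCuts-keepNonBinary z)))
        (childCutsL-length ms))))
      (childCuts-keepNonBinary a)))

  childCuts-keepNonBinary : ∀ t → All (KeepsNonBinary t) (childCuts t)
  childCuts-keepNonBinary leaf = (λ ()) ∷ []
  childCuts-keepNonBinary (node a ms z) =
    (λ h → inj₂ (here h)) ∷ cuts-keepNonBinary (node a ms z)

module Biideal {c ℓ : Level} (K : Field c ℓ) where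
  open Field K
  open Tri K
  open import Algebra.Properties.Ring ring using (-1*x≈-x)
  open import Algebra.Properties.Group +-group using (x∙y⁻¹≈ε⇒x≈y; x≈y⇒x∙y⁻¹≈ε)
  open import Algebra.Properties.CommutativeSemigroup +-commutativeSemigroup
    using (interchange; x∙yz≈y∙xz)
  open import Relation.Binary.Reasoning.Setoid setoid

  selectR⁺ : ∀ {p} {P : Cut → Set p} b cs → All P cs → All P (selectR b cs)
  selectR⁺ b [] [] = []
  selectR⁺ true ((_ , _ , true) ∷ cs) (h ∷ hs) = h ∷ selectR⁺ true cs hs
  selectR⁺ true ((_ , _ , false) ∷ cs) (h ∷ hs) = selectR⁺ true cs hs
  selectR⁺ false ((_ , _ , true) ∷ cs) (h ∷ hs) = selectR⁺ false cs hs
  selectR⁺ false ((_ , _ , false) ∷ cs) (h ∷ hs) = h ∷ selectR⁺ false cs hs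

  coeff-⊕ : ∀ t u v → coeff t (u ⊕ v) ≈ coeff t u + coeff t v
  coeff-⊕ t [] v = sym (+-identityˡ _)
  coeff-⊕ t ((a , s) ∷ u) v with s ≟T t
  ... | yes _ = trans (+-congˡ (coeff-⊕ t u v)) (sym (+-assoc _ _ _))
  ... | no _ = coeff-⊕ t u v

  coeff-·ₛ : ∀ t a u → coeff t (a ·ₛ u) ≈ a * coeff t u
  coeff-·ₛ t a [] = sym (zeroʳ a)
  coeff-·ₛ t a ((b , s) ∷ u) with s ≟T t
  ... | yes _ = trans (+-congˡ (coeff-·ₛ t a u)) (sym (distribˡ a b _))
  ... | no _ = coeff-·ₛ t a u

  _·₂_ : Carrier → FS2 → FS2
  a ·₂ w = map (λ q → (a * proj₁ q , proj₂ q)) w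

  coeff2-++ : ∀ τ w w′ → coeff2 τ (w ++ w′) ≈ coeff2 τ w + coeff2 τ w′
  coeff2-++ τ [] w′ = sym (+-identityˡ _)
  coeff2-++ τ ((a , σ) ∷ w) w′ with σ ≟T2 τ
  ... | yes _ = trans (+-congˡ (coeff2-++ τ w w′)) (sym (+-assoc _ _ _))
  ... | no _ = coeff2-++ τ w w′

  coeff2-·₂ : ∀ τ a w → coeff2 τ (a ·₂ w) ≈ a * coeff2 τ w
  coeff2-·₂ τ a [] = sym (zeroʳ a)
  coeff2-·₂ τ a ((b , σ) ∷ w) with σ ≟T2 τ
  ... | yes _ = trans (+-congˡ (coeff2-·₂ τ a w)) (sym (distribˡ a b _))
  ... | no _ = coeff2-·₂ τ a w

  Lin : (Tree → Carrier) → FS → Carrier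
  Lin F [] = 0#
  Lin F ((a , s) ∷ u) = a * F s + Lin F u

  Lin-⊕ : ∀ F u v → Lin F (u ⊕ v) ≈ Lin F u + Lin F v
  Lin-⊕ F [] v = sym (+-identityˡ _)
  Lin-⊕ F ((a , s) ∷ u) v = trans (+-congˡ (Lin-⊕ F u v)) (sym (+-assoc _ _ _))

  Lin-·ₛ : ∀ F b u → Lin F (b ·ₛ u) ≈ b * Lin F u
  Lin-·ₛ F b [] = sym (zeroʳ b)
  Lin-·ₛ F b ((a , s) ∷ u) =
    trans (+-cong (*-assoc b a (F s)) (Lin-·ₛ F b u)) (sym (distribˡ b _ _))

  Lin-congˡ : ∀ {F G} → (∀ s → F s ≈ G s) → ∀ u → Lin F u ≈ Lin G u
  Lin-congˡ F≈G [] = refl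
  Lin-congˡ F≈G ((a , s) ∷ u) = +-cong (*-congˡ (F≈G s)) (Lin-congˡ F≈G u)

  dropTree : Tree → FS → FS
  dropTree s [] = []
  dropTree s ((a , t) ∷ u) with t ≟T s
  ... | yes _ = dropTree s u
  ... | no _ = (a , t) ∷ dropTree s u

  Lin-dropTree : ∀ F s u → Lin F u ≈ coeff s u * F s + Lin F (dropTree s u)
  Lin-dropTree F s [] = sym (trans (+-identityʳ _) (zeroˡ _))
  Lin-dropTree F s ((a , t) ∷ u) with t ≟T s
  ... | yes ≡.refl =
    trans (+-congˡ (Lin-dropTree F t u))
      (trans (sym (+-assoc _ _ _)) (+-congʳ (sym (distribʳ (F t) a (coeff t u)))))
  ... | no _ = trans (+-congˡ (Lin-dropTree F s u)) (x∙yz≈y∙xz _ _ _)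

  coeff-dropTree-self : ∀ s u → coeff s (dropTree s u) ≈ 0#
  coeff-dropTree-self s [] = refl
  coeff-dropTree-self s ((a , t) ∷ u) with t ≟T s
  ... | yes _ = coeff-dropTree-self s u
  ... | no t≢s with t ≟T s
  ...   | yes t≡s = contradiction t≡s t≢s
  ...   | no _ = coeff-dropTree-self s u

  coeff-dropTree-other : ∀ s t u → ¬ (t ≡ s) → coeff t (dropTree s u) ≈ coeff t u
  coeff-dropTree-other s t [] _ = refl
  coeff-dropTree-other s t ((a , r) ∷ u) t≢s with r ≟T s
  ... | yes ≡.refl with r ≟T t
  ...   | yes r≡t = contradiction (≡.sym r≡t) t≢s
  ...   | no _ = coeff-dropTree-other s t u t≢s
  coeff-dropTree-other s t ((a , r) ∷ u) t≢s | no _ with r ≟T t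
  ...   | yes _ = +-congˡ (coeff-dropTree-other s t u t≢s)
  ...   | no _ = coeff-dropTree-other s t u t≢s

  dropTree-cong : ∀ s u v → u ≋ v → dropTree s u ≋ dropTree s v
  dropTree-cong s u v u≋v t with t ≟T s
  ... | yes ≡.refl = trans (coeff-dropTree-self s u) (sym (coeff-dropTree-self s v))
  ... | no t≢s =
    trans (coeff-dropTree-other s t u t≢s)
      (trans (u≋v t) (sym (coeff-dropTree-other s t v t≢s)))

  length-dropTree : ∀ s u → length (dropTree s u) ≤ length u
  length-dropTree s [] = ≤-refl
  length-dropTree s ((a , t) ∷ u) with t ≟T s
  ... | yes _ = m≤n⇒m≤1+n (length-dropTree s u)
  ... | no _ = s≤s (length-dropTree s u)

  dropTree-shortens : ∀ s a u → length (dropTree s ((a , s) ∷ u)) ≤ length u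
  dropTree-shortens s a u with s ≟T s
  ... | yes _ = length-dropTree s u
  ... | no s≢s = contradiction ≡.refl s≢s

  Lin-zero : ∀ F u → u ≋ zeroV → Lin F u ≈ 0#
  Lin-zero F u = go (length u) u ≤-refl
    where
    go : ∀ n u → length u ≤ n → u ≋ zeroV → Lin F u ≈ 0#
    go _ [] _ _ = refl
    go (suc n) u@((a , s) ∷ w) (s≤s |w|≤n) u≋0 = begin
      Lin F u                                 ≈⟨ Lin-dropTree F s u ⟩
      coeff s u * F s + Lin F (dropTree s u)
        ≈⟨ +-cong (trans (*-congʳ (u≋0 s)) (zeroˡ _)) dropped≈0 ⟩
      0# + 0#                                 ≈⟨ +-identityˡ 0# ⟩
      0#                                      ∎
      where
      dropped≈0 : Lin F (dropTree s u) ≈ 0#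
      dropped≈0 = go n (dropTree s u) (≤-trans (dropTree-shortens s a w) |w|≤n)
                    (dropTree-cong s u zeroV u≋0)

  -- Lin F vanishes on u − v.
  Lin-cong : ∀ F u v → u ≋ v → Lin F u ≈ Lin F v
  Lin-cong F u v u≋v = x∙y⁻¹≈ε⇒x≈y _ _ (begin
    Lin F u + - Lin F v                 ≈⟨ +-congˡ (sym (-1*x≈-x _)) ⟩
    Lin F u + (- 1#) * Lin F v          ≈⟨ +-congˡ (sym (Lin-·ₛ F (- 1#) v)) ⟩
    Lin F u + Lin F ((- 1#) ·ₛ v)       ≈⟨ sym (Lin-⊕ F u _) ⟩
    Lin F (u ⊕ ((- 1#) ·ₛ v))           ≈⟨ Lin-zero F (u ⊕ ((- 1#) ·ₛ v)) difference≋0 ⟩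
    0#                                  ∎)
    where
    difference≋0 : (u ⊕ ((- 1#) ·ₛ v)) ≋ zeroV
    difference≋0 t = begin
      coeff t (u ⊕ ((- 1#) ·ₛ v))         ≈⟨ coeff-⊕ t u _ ⟩
      coeff t u + coeff t ((- 1#) ·ₛ v)   ≈⟨ +-congˡ (trans (coeff-·ₛ t (- 1#) v) (-1*x≈-x _)) ⟩
      coeff t u + - coeff t v             ≈⟨ x≈y⇒x∙y⁻¹≈ε (u≋v t) ⟩
      0#                                  ∎

  coeff-bilin : ∀ t op u v →
    coeff t (bilin op u v) ≈ Lin (λ s → Lin (λ s′ → coeff t (op s s′)) v) u
  coeff-bilin t op [] v = refl
  coeff-bilin t op ((a , s) ∷ u) v =
    trans (coeff-⊕ t (row v) _) (+-cong (coeff-row v) (coeff-bilin t op u v))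
    where
    row : FS → FS
    row v = concatMap (λ q → (a * proj₁ q) ·ₛ op s (proj₂ q)) v
    coeff-row : ∀ v → coeff t (row v) ≈ a * Lin (λ s′ → coeff t (op s s′)) v
    coeff-row [] = sym (zeroʳ a)
    coeff-row ((b , s′) ∷ v) =
      trans (coeff-⊕ t ((a * b) ·ₛ op s s′) _)
        (trans (+-cong (trans (coeff-·ₛ t (a * b) (op s s′)) (*-assoc a b _)) (coeff-row v))
          (sym (distribˡ a _ _)))

  bilin-cong : ∀ op u u′ v v′ → u ≋ u′ → v ≋ v′ → bilin op u v ≋ bilin op u′ v′
  bilin-cong op u u′ v v′ u≋u′ v≋v′ t = begin
    coeff t (bilin op u v)                              ≈⟨ coeff-bilin t op u v ⟩
    Lin (λ s → Lin (λ s′ → coeff t (op s s′)) v) u     ≈⟨ Lin-congˡ (λ s → Lin-cong _ v v′ v≋v′) u ⟩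
    Lin (λ s → Lin (λ s′ → coeff t (op s s′)) v′) u    ≈⟨ Lin-cong _ u u′ u≋u′ ⟩
    Lin (λ s → Lin (λ s′ → coeff t (op s s′)) v′) u′   ≈⟨ coeff-bilin t op u′ v′ ⟨
    coeff t (bilin op u′ v′)                            ∎

  bilin-⟦⟧ : ∀ op s s′ → bilin op ⟦ s ⟧ ⟦ s′ ⟧ ≋ op s s′
  bilin-⟦⟧ op s s′ t =
    trans (coeff-bilin t op ⟦ s ⟧ ⟦ s′ ⟧)
      (trans (+-identityʳ _) (trans (*-identityˡ _) (trans (+-identityʳ _) (*-identityˡ _))))

  coeff2-lin2 : ∀ τ f u → coeff2 τ (lin2 f u) ≈ Lin (λ s → coeff2 τ (f s)) u
  coeff2-lin2 τ f [] = refl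
  coeff2-lin2 τ f ((a , s) ∷ u) =
    trans (coeff2-++ τ (a ·₂ f s) _) (+-cong (coeff2-·₂ τ a (f s)) (coeff2-lin2 τ f u))

  lin2-cong : ∀ f u v → u ≋ v → lin2 f u ≋2 lin2 f v
  lin2-cong f u v u≋v τ =
    trans (coeff2-lin2 τ f u) (trans (Lin-cong _ u v u≋v) (sym (coeff2-lin2 τ f v)))

  AllNonBinary : FS → Set c
  AllNonBinary = All (NonBinary ∘ proj₂)

  Absorbing : (Tree → Tree → FS) → Set c
  Absorbing op = ∀ s t → NonBinary s ⊎ NonBinary t → AllNonBinary (op s t)

  allNonBinary-bilin : ∀ op u v →
    All (λ p → All (λ q → AllNonBinary (op (proj₂ p) (proj₂ q))) v) u →
    AllNonBinary (bilin op u v)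
  allNonBinary-bilin op u v h = concat⁺ (map⁺ (All.map (concat⁺ ∘ map⁺ ∘ All.map map⁺) h))

  bilin-absorbsˡ : ∀ {op} → Absorbing op → ∀ {u} v → AllNonBinary u → AllNonBinary (bilin op u v)
  bilin-absorbsˡ absorbing v hu =
    allNonBinary-bilin _ _ v (All.map (λ hs → All.universal (λ q → absorbing _ _ (inj₁ hs)) v) hu)

  bilin-absorbsʳ : ∀ {op} → Absorbing op → ∀ u {v} → AllNonBinary v → AllNonBinary (bilin op u v)
  bilin-absorbsʳ absorbing u hv =
    allNonBinary-bilin _ u _ (All.universal (λ p → All.map (λ ht → absorbing _ _ (inj₂ ht)) hv) u)

  dotT-nonBinary : ∀ s t → AllNonBinary (dotT s t)
  dotT-nonBinary leaf t = []
  dotT-nonBinary (node a ms z) leaf = []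
  dotT-nonBinary (node a ms z) (node b ns w) =
    map⁺ (All.universal (λ p → nonBinary-node-wide a ms (proj₂ p) ns w) (starT z b))

  ·-nonBinary : ∀ u v → AllNonBinary (u · v)
  ·-nonBinary u v =
    allNonBinary-bilin dotT u v
      (All.universal (λ p → All.universal (λ q → dotT-nonBinary (proj₂ p) (proj₂ q)) v) u)

  mutual
    precT-absorbing : Absorbing precT
    precT-absorbing leaf t _ = []
    precT-absorbing (node a ms z) leaf (inj₁ h) = h ∷ []
    precT-absorbing (node a ms z) t@(node _ _ _) (inj₁ h) =
      Sum.[ (λ hz → map⁺ (All.map (nonBinary-nodeʳ a ms) (starT-absorbing z t (inj₁ hz))))
          , (λ k → map⁺ (All.universal (k ∘ proj₂) _)) ]
        (nonBinary-node-last a ms z h)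
    precT-absorbing (node a ms z) t@(node _ _ _) (inj₂ h) =
      map⁺ (All.map (nonBinary-nodeʳ a ms) (starT-absorbing z t (inj₂ h)))

    succT-absorbing : Absorbing succT
    succT-absorbing s leaf _ = []
    succT-absorbing leaf (node b ns w) (inj₂ h) = h ∷ []
    succT-absorbing s@(node _ _ _) (node b ns w) (inj₁ h) =
      map⁺ (All.map (nonBinary-nodeˡ ns w) (starT-absorbing s b (inj₁ h)))
    succT-absorbing s@(node _ _ _) (node b ns w) (inj₂ h) =
      Sum.[ (λ hb → map⁺ (All.map (nonBinary-nodeˡ ns w) (starT-absorbing s b (inj₂ hb))))
          , (λ k → map⁺ (All.universal (k ∘ proj₂) _)) ]
        (nonBinary-node-first b ns w h)

    starT-absorbing : Absorbing starT
    starT-absorbing leaf leaf (inj₁ ())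
    starT-absorbing leaf leaf (inj₂ ())
    starT-absorbing leaf t@(node _ _ _) h = succT-absorbing leaf t h
    starT-absorbing s@(node _ _ _) t h =
      ++⁺ (precT-absorbing s t h) (++⁺ (dotT-nonBinary s t) (succT-absorbing s t h))

  starList-nonBinary : ∀ gs → Any NonBinary gs → AllNonBinary (starList gs)
  starList-nonBinary (g ∷ []) (here h) = h ∷ []
  starList-nonBinary (g ∷ gs@(_ ∷ _)) (here h) =
    bilin-absorbsˡ starT-absorbing (starList gs) (h ∷ [])
  starList-nonBinary (g ∷ gs@(_ ∷ _)) (there h) =
    bilin-absorbsʳ starT-absorbing ⟦ g ⟧ (starList-nonBinary gs h)

  NonBinarySpan : FS → Set (c ⊔ ℓ)
  NonBinarySpan u = Σ FS λ u′ → u ≋ u′ × AllNonBinary u′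

  span-⊕ : ∀ u v → NonBinarySpan u → NonBinarySpan v → NonBinarySpan (u ⊕ v)
  span-⊕ u v (u′ , u≋u′ , hu′) (v′ , v≋v′ , hv′) =
    u′ ⊕ v′ ,
    (λ t → trans (coeff-⊕ t u v) (trans (+-cong (u≋u′ t) (v≋v′ t)) (sym (coeff-⊕ t u′ v′)))) ,
    ++⁺ hu′ hv′

  span-·ₛ : ∀ a u → NonBinarySpan u → NonBinarySpan (a ·ₛ u)
  span-·ₛ a u (u′ , u≋u′ , hu′) =
    a ·ₛ u′ ,
    (λ t → trans (coeff-·ₛ t a u) (trans (*-congˡ (u≋u′ t)) (sym (coeff-·ₛ t a u′)))) ,
    map⁺ hu′

  span-resp : ∀ u v → u ≋ v → NonBinarySpan u → NonBinarySpan v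
  span-resp u v u≋v (u′ , u≋u′ , hu′) = u′ , (λ t → trans (sym (u≋v t)) (u≋u′ t)) , hu′

  span-bilinˡ : ∀ {op} → Absorbing op → ∀ x y → NonBinarySpan x → NonBinarySpan (bilin op x y)
  span-bilinˡ absorbing x y (x′ , x≋x′ , hx′) =
    bilin _ x′ y , bilin-cong _ x x′ y y x≋x′ (λ _ → refl) , bilin-absorbsˡ absorbing y hx′

  span-bilinʳ : ∀ {op} → Absorbing op → ∀ x y → NonBinarySpan y → NonBinarySpan (bilin op x y)
  span-bilinʳ absorbing x y (y′ , y≋y′ , hy′) =
    bilin _ x y′ , bilin-cong _ x x y y′ (λ _ → refl) y≋y′ , bilin-absorbsʳ absorbing x hy′

  span-· : ∀ x y → NonBinarySpan (x · y)
  span-· x y = x · y , (λ _ → refl) , ·-nonBinary x y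

  InI⇒span : ∀ {u} → InI u → NonBinarySpan u
  InI⇒span (gen {x} {y} _ _) = span-· x y
  InI⇒span zeroI = [] , (λ _ → refl) , []
  InI⇒span (addI {u} {v} iu iv) = span-⊕ u v (InI⇒span iu) (InI⇒span iv)
  InI⇒span (scaleI a {u} iu) = span-·ₛ a u (InI⇒span iu)
  InI⇒span (respI {u} {v} u≋v iu) = span-resp u v u≋v (InI⇒span iu)
  InI⇒span (≺ˡ {x} {y} ix _) = span-bilinˡ precT-absorbing x y (InI⇒span ix)
  InI⇒span (≺ʳ {x} {y} _ iy) = span-bilinʳ precT-absorbing x y (InI⇒span iy)
  InI⇒span (·ˡ {x} {y} _ _) = span-· x y
  InI⇒span (·ʳ {x} {y} _ _) = span-· x y
  InI⇒span (≻ˡ {x} {y} ix _) = span-bilinˡ succT-absorbing x y (InI⇒span ix)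
  InI⇒span (≻ʳ {x} {y} _ iy) = span-bilinʳ succT-absorbing x y (InI⇒span iy)

  -- The first middle child is split on so that starT | m computes.
  nonBinary-InI : ∀ t → NonBinary t → InI ⟦ t ⟧
  nonBinary-InI (node a (leaf ∷ ms) z) _ =
    respI (bilin-⟦⟧ dotT (node a [] leaf) (node leaf ms z))
      (gen {⟦ node a [] leaf ⟧} {⟦ node leaf ms z ⟧} refl refl)
  nonBinary-InI (node a (m@(node _ _ _) ∷ ms) z) _ =
    respI (bilin-⟦⟧ dotT (node a [] leaf) (node m ms z))
      (gen {⟦ node a [] leaf ⟧} {⟦ node m ms z ⟧} refl refl)
  nonBinary-InI (node a@(node _ _ _) [] z) (inj₁ ha) =
    respI (bilin-⟦⟧ succT a (node leaf [] z))
      (≻ˡ {y = ⟦ node leaf [] z ⟧} (nonBinary-InI a ha) refl)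
  nonBinary-InI (node a [] z@(node _ _ _)) (inj₂ hz) =
    respI (bilin-⟦⟧ precT (node a [] leaf) z)
      (≺ʳ {⟦ node a [] leaf ⟧} refl (nonBinary-InI z hz))

  allNonBinary-InI : ∀ u → AllNonBinary u → InI u
  allNonBinary-InI [] [] = zeroI
  allNonBinary-InI ((a , t) ∷ u) (h ∷ hs) =
    respI unscale (addI (scaleI a (nonBinary-InI t h)) (allNonBinary-InI u hs))
    where
    unscale : ((a * 1# , t) ∷ u) ≋ ((a , t) ∷ u)
    unscale t′ with t ≟T t′
    ... | yes _ = +-congʳ (*-identityʳ a)
    ... | no _ = refl

  span⇒InI : ∀ {u} → NonBinarySpan u → InI u
  span⇒InI (u′ , u≋u′ , hu′) = respI (λ t → sym (u≋u′ t)) (allNonBinary-InI u′ hu′)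

  coeff-leaf-allNonBinary : ∀ u → AllNonBinary u → coeff leaf u ≈ 0#
  coeff-leaf-allNonBinary [] [] = refl
  coeff-leaf-allNonBinary ((a , node _ _ _) ∷ u) (_ ∷ hs) = coeff-leaf-allNonBinary u hs

  tensorSum : List (FS × FS) → FS2
  tensorSum = concatMap (λ p → proj₁ p ⊗ proj₂ p)

  ⊗-·ₛ : ∀ τ a U V → coeff2 τ ((a ·ₛ U) ⊗ V) ≈ a * coeff2 τ (U ⊗ V)
  ⊗-·ₛ τ a [] V = sym (zeroʳ a)
  ⊗-·ₛ τ a ((b , s) ∷ U) V = begin
    coeff2 τ (row (a * b) ++ (a ·ₛ U) ⊗ V)            ≈⟨ coeff2-++ τ (row (a * b)) _ ⟩
    coeff2 τ (row (a * b)) + coeff2 τ ((a ·ₛ U) ⊗ V)  ≈⟨ +-cong (coeff2-row V) (⊗-·ₛ τ a U V) ⟩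
    a * coeff2 τ (row b) + a * coeff2 τ (U ⊗ V)       ≈⟨ distribˡ a _ _ ⟨
    a * (coeff2 τ (row b) + coeff2 τ (U ⊗ V))         ≈⟨ *-congˡ (coeff2-++ τ (row b) _) ⟨
    a * coeff2 τ (row b ++ U ⊗ V)                     ∎
    where
    row : Carrier → FS2
    row b = map (λ q → (b * proj₁ q , (s , proj₂ q))) V
    coeff2-row : ∀ V → coeff2 τ (map (λ q → ((a * b) * proj₁ q , (s , proj₂ q))) V)
                     ≈ a * coeff2 τ (map (λ q → (b * proj₁ q , (s , proj₂ q))) V)
    coeff2-row [] = sym (zeroʳ a)
    coeff2-row ((d , s′) ∷ V) with (s , s′) ≟T2 τ
    ... | yes _ = trans (+-cong (*-assoc a b d) (coeff2-row V)) (sym (distribˡ a _ _))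
    ... | no _ = coeff2-row V

  tensorSum-·ₛ : ∀ τ a L → coeff2 τ (tensorSum (map (map₁ (a ·ₛ_)) L)) ≈ a * coeff2 τ (tensorSum L)
  tensorSum-·ₛ τ a [] = sym (zeroʳ a)
  tensorSum-·ₛ τ a ((U , V) ∷ L) = begin
    coeff2 τ ((a ·ₛ U) ⊗ V ++ tensorSum (map (map₁ (a ·ₛ_)) L))
      ≈⟨ coeff2-++ τ ((a ·ₛ U) ⊗ V) _ ⟩
    coeff2 τ ((a ·ₛ U) ⊗ V) + coeff2 τ (tensorSum (map (map₁ (a ·ₛ_)) L))
      ≈⟨ +-cong (⊗-·ₛ τ a U V) (tensorSum-·ₛ τ a L) ⟩
    a * coeff2 τ (U ⊗ V) + a * coeff2 τ (tensorSum L)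
      ≈⟨ distribˡ a _ _ ⟨
    a * (coeff2 τ (U ⊗ V) + coeff2 τ (tensorSum L))
      ≈⟨ *-congˡ (coeff2-++ τ (U ⊗ V) _) ⟨
    a * coeff2 τ (U ⊗ V ++ tensorSum L)
      ∎

  InI⊗A+A⊗I-resp : ∀ {w w′} → w ≋2 w′ → InI⊗A+A⊗I w′ → InI⊗A+A⊗I w
  InI⊗A+A⊗I-resp w≋w′ (L₁ , L₂ , i₁ , i₂ , w′≋) = L₁ , L₂ , i₁ , i₂ , (λ τ → trans (w≋w′ τ) (w′≋ τ))

  ⊗-InIˡ : ∀ {U} V → InI U → InI⊗A+A⊗I (U ⊗ V)
  ⊗-InIˡ {U} V iU =
    (U , V) ∷ [] , [] , iU ∷ [] , [] ,
    (λ τ → reflexive (≡.cong (coeff2 τ)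
             (≡.sym (≡.trans (++-identityʳ (U ⊗ V ++ [])) (++-identityʳ (U ⊗ V))))))

  ⊗-InIʳ : ∀ U {V} → InI V → InI⊗A+A⊗I (U ⊗ V)
  ⊗-InIʳ U {V} iV =
    [] , (U , V) ∷ [] , [] , iV ∷ [] ,
    (λ τ → reflexive (≡.cong (coeff2 τ) (≡.sym (++-identityʳ (U ⊗ V)))))

  InI⊗A+A⊗I-++ : ∀ {w w′} → InI⊗A+A⊗I w → InI⊗A+A⊗I w′ → InI⊗A+A⊗I (w ++ w′)
  InI⊗A+A⊗I-++ {w} {w′} (L₁ , L₂ , i₁ , i₂ , w≋) (M₁ , M₂ , j₁ , j₂ , w′≋) =
    L₁ ++ M₁ , L₂ ++ M₂ , ++⁺ i₁ j₁ , ++⁺ i₂ j₂ , λ τ → begin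
      coeff2 τ (w ++ w′)
        ≈⟨ coeff2-++ τ w w′ ⟩
      coeff2 τ w + coeff2 τ w′
        ≈⟨ +-cong (trans (w≋ τ) (coeff2-++ τ (tensorSum L₁) (tensorSum L₂)))
                  (trans (w′≋ τ) (coeff2-++ τ (tensorSum M₁) (tensorSum M₂))) ⟩
      (⟪ L₁ ⟫ τ + ⟪ L₂ ⟫ τ) + (⟪ M₁ ⟫ τ + ⟪ M₂ ⟫ τ)
        ≈⟨ interchange _ _ _ _ ⟩
      (⟪ L₁ ⟫ τ + ⟪ M₁ ⟫ τ) + (⟪ L₂ ⟫ τ + ⟪ M₂ ⟫ τ)
        ≈⟨ +-cong (⟪++⟫ L₁ M₁) (⟪++⟫ L₂ M₂) ⟨
      ⟪ L₁ ++ M₁ ⟫ τ + ⟪ L₂ ++ M₂ ⟫ τ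
        ≈⟨ coeff2-++ τ (tensorSum (L₁ ++ M₁)) _ ⟨
      coeff2 τ (tensorSum (L₁ ++ M₁) ++ tensorSum (L₂ ++ M₂))
        ∎
    where
    ⟪_⟫ : List (FS × FS) → Tree × Tree → Carrier
    ⟪ L ⟫ τ = coeff2 τ (tensorSum L)
    ⟪++⟫ : ∀ L M {τ} → ⟪ L ++ M ⟫ τ ≈ ⟪ L ⟫ τ + ⟪ M ⟫ τ
    ⟪++⟫ L M {τ} = trans (reflexive (≡.cong (coeff2 τ) (concatMap-++ _ L M)))
                         (coeff2-++ τ (tensorSum L) (tensorSum M))

  InI⊗A+A⊗I-concat : ∀ {ws} → All InI⊗A+A⊗I ws → InI⊗A+A⊗I (concat ws)
  InI⊗A+A⊗I-concat [] = [] , [] , [] , [] , λ _ → refl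
  InI⊗A+A⊗I-concat {w ∷ ws} (h ∷ hs) = InI⊗A+A⊗I-++ {w} {concat ws} h (InI⊗A+A⊗I-concat hs)

  InI⊗A+A⊗I-·₂ : ∀ a {w} → InI⊗A+A⊗I w → InI⊗A+A⊗I (a ·₂ w)
  InI⊗A+A⊗I-·₂ a {w} (L₁ , L₂ , i₁ , i₂ , w≋) =
    map (map₁ (a ·ₛ_)) L₁ , map (map₁ (a ·ₛ_)) L₂ , map⁺ (All.map (scaleI a) i₁) , map⁺ i₂ ,
    λ τ → begin
      coeff2 τ (a ·₂ w)
        ≈⟨ coeff2-·₂ τ a w ⟩
      a * coeff2 τ w
        ≈⟨ *-congˡ (trans (w≋ τ) (coeff2-++ τ (tensorSum L₁) (tensorSum L₂))) ⟩
      a * (coeff2 τ (tensorSum L₁) + coeff2 τ (tensorSum L₂))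
        ≈⟨ distribˡ a _ _ ⟩
      a * coeff2 τ (tensorSum L₁) + a * coeff2 τ (tensorSum L₂)
        ≈⟨ +-cong (tensorSum-·ₛ τ a L₁) (tensorSum-·ₛ τ a L₂) ⟨
      coeff2 τ (tensorSum (map (map₁ (a ·ₛ_)) L₁)) + coeff2 τ (tensorSum (map (map₁ (a ·ₛ_)) L₂))
        ≈⟨ coeff2-++ τ (tensorSum (map (map₁ (a ·ₛ_)) L₁)) _ ⟨
      coeff2 τ (tensorSum (map (map₁ (a ·ₛ_)) L₁) ++ tensorSum (map (map₁ (a ·ₛ_)) L₂))
        ∎

  lin2-preserves : ∀ f → (∀ t → NonBinary t → InI⊗A+A⊗I (f t)) →
                   ∀ {x} → InI x → InI⊗A+A⊗I (lin2 f x)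
  lin2-preserves f hf {x} ix = preserve (InI⇒span ix)
    where
    preserve : NonBinarySpan x → InI⊗A+A⊗I (lin2 f x)
    preserve (x′ , x≋x′ , hx′) =
      InI⊗A+A⊗I-resp {lin2 f x} {lin2 f x′} (lin2-cong f x x′ x≋x′)
        (InI⊗A+A⊗I-concat (map⁺ (All.map
          (λ {p} h → InI⊗A+A⊗I-·₂ (proj₁ p) {f (proj₂ p)} (hf (proj₂ p) h)) hx′)))

  cutTerm-InI⊗A+A⊗I : ∀ {t} → NonBinary t → ∀ c → KeepsNonBinary t c → InI⊗A+A⊗I (cutTerm c)
  cutTerm-InI⊗A+A⊗I h (gs , p , _) keeps =
    Sum.[ ⊗-InIʳ (starList gs) ∘ nonBinary-InI p
        , ⊗-InIˡ ⟦ p ⟧ ∘ allNonBinary-InI (starList gs) ∘ starList-nonBinary gs ] (keeps h)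

  selectedCuts-InI⊗A+A⊗I : ∀ b t → NonBinary t → InI⊗A+A⊗I (concatMap cutTerm (selectR b (cuts t)))
  selectedCuts-InI⊗A+A⊗I b t h =
    InI⊗A+A⊗I-concat (map⁺ (All.map (λ {c} → cutTerm-InI⊗A+A⊗I h c)
      (selectR⁺ b (cuts t) (cuts-keepNonBinary t))))

  Δ←T-InI⊗A+A⊗I : ∀ t → NonBinary t → InI⊗A+A⊗I (Δ←T t)
  Δ←T-InI⊗A+A⊗I t@(node _ _ _) h =
    InI⊗A+A⊗I-++ {⟦ t ⟧ ⊗ ⟦ leaf ⟧}
      (⊗-InIˡ ⟦ leaf ⟧ (nonBinary-InI t h)) (selectedCuts-InI⊗A+A⊗I true t h)

  Δ→T-InI⊗A+A⊗I : ∀ t → NonBinary t → InI⊗A+A⊗I (Δ→T t)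
  Δ→T-InI⊗A+A⊗I t@(node _ _ _) h = selectedCuts-InI⊗A+A⊗I false t h

  isTriIdeal : IsTriIdeal InI
  isTriIdeal = (λ {x} y ix → closed x y (inj₁ (InI⇒span ix)))
             , (λ x {y} iy → closed x y (inj₂ (InI⇒span iy)))
    where
    closed : ∀ x y → NonBinarySpan x ⊎ NonBinarySpan y → InI (x ≺ y) × InI (x · y) × InI (x ≻ y)
    closed x y (inj₁ sx) =
      span⇒InI (span-bilinˡ precT-absorbing x y sx) , span⇒InI (span-· x y) ,
      span⇒InI (span-bilinˡ succT-absorbing x y sx)
    closed x y (inj₂ sy) =
      span⇒InI (span-bilinʳ precT-absorbing x y sy) , span⇒InI (span-· x y) ,
      span⇒InI (span-bilinʳ succT-absorbing x y sy)

  ε-InI : ∀ {x} → InI x → ε x ≈ 0#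
  ε-InI ix with InI⇒span ix
  ... | x′ , x≋x′ , hx′ = trans (x≋x′ leaf) (coeff-leaf-allNonBinary x′ hx′)

mainTheorem18 : ∀ {c ℓ : Level} (K : Field c ℓ) → Tri.IsBiidealI K
mainTheorem18 K =
  isTriIdeal , ε-InI , lin2-preserves Δ←T Δ←T-InI⊗A+A⊗I , lin2-preserves Δ→T Δ→T-InI⊗A+A⊗I
  where
  open Biideal K
  open Tri K using (Δ←T; Δ→T)
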